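{- Let $\Delta$ be a pure $d$-dimensional simplicial complex. Then $\Delta$ is strongly shellable if and only if there exists an $h$-assignment $A$ of $\Delta$ such that all facets of $\Delta$ can be removed by successively applying removing steps, where at each step the facet removed is a strong candidate facet of the current complex with respect to the current (restricted) assignment.
   Context: A simplicial complex is a finite family of subsets of a vertex set closed under taking subsets; $\mathcal{F}(\Delta)$ is its set of facets, $\dim(A)=|A|-1$; $\Delta$ is pure if all facets have the same dimension. A linear order $F_1,\dots,F_t$ of $\mathcal{F}(\Delta)$ is a strong shelling order if for every $1\le i<j\le t$ there exists $k$ with $1\le k<j$ such that $|F_j\setminus F_k|=1$, $F_j\setminus F_k\subseteq F_j\setminus F_i$, and $F_k\setminus F_j\subseteq F_i$; $\Delta$ is strongly shellable if such an order exists. For facets $F,G$ of a pure complex, $\operatorname{dis}(F,G)=|F\setminus G|$. Let $\mathbf{h}(\Delta)=(h_0(\Delta),\dots,h_{d+1}(\Delta))$ be the (standard) $h$-vector of $\Delta$. A ridge is a $(d-1)$-dimensional face; a boundary ridge is a ridge contained in exactly one facet. An $h$-assignment of $\Delta$ is a map $A:\mathcal{F}(\Delta)\to\{0,1,\dots,d+1\}$ with $|A^{ -1}(i)|=h_i(\Delta)$ for each $i$. Given a pure complex $\Delta'$ and a map $A$ on $\mathcal{F}(\Delta')$, a facet $F$ of $\Delta'$ is a candidate facet if $F$ contains exactly $d+1-A(F)$ boundary ridges of $\Delta'$; it is a strong candidate facet if moreover for every facet $G\neq F$ of $\Delta'$ there is a facet $H$ of $\Delta'$ with $\operatorname{dis}(F,H)=1$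 and $\operatorname{dis}(G,H)=\operatorname{dis}(G,F)-1$. A removing step applied to a candidate facet $F$ replaces $\Delta'$ by the complex generated by $\mathcal{F}(\Delta')\setminus\{F\}$ and $A$ by its restriction to the remaining facets. -}

module Defs where

open import Data.Nat as ℕ using (ℕ; zero; suc; _∸_; _≤_)
open import Data.Nat.Combinatorics using (_C_)
open import Data.Integer as ℤ using (ℤ; +_; -_)
open import Data.Fin as Fin using (Fin)
open import Data.Fin.Subset using (Subset; inside; outside; _⊆_; _─_; ∣_∣)
open import Data.Fin.Subset.Properties using (_⊆?_)
open import Data.Vec using ([]; _∷_)
open import Data.Vec.Properties using (≡-dec)
open import Data.Bool.Properties using () renaming (_≟_ to _≟ᵇ_)
open import Data.List using (List; []; _∷_; _++_; map; filter; length; lookup; removeAt; zip; upTo; foldr)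
open import Data.List.Relation.Unary.Any using (Any; any?)
open import Data.List.Relation.Binary.Permutation.Propositional using (_↭_)
open import Data.Product using (Σ; ∃; _×_; _,_; proj₁; proj₂)
open import Relation.Nullary using (¬_; Dec)
open import Relation.Nullary.Decidable using (_×-dec_)
open import Relation.Binary.PropositionalEquality using (_≡_; _≢_)

-- Faces are subsets of the finite vertex set Fin n.  A pure complex is
-- given by its list of facets (the complex they generate is the set of
-- all subsets of facets).

_≟ₛ_ : ∀ {n} (A B : Subset n) → Dec (A ≡ B)
_≟ₛ_ = ≡-dec _≟ᵇ_

allSubsets : ∀ n → List (Subset n)
allSubsets zero = [] ∷ []
allSubsets (suc n) = map (inside ∷_) (allSubsets n) ++ map (outside ∷_) (allSubsets n)

countL : ∀ {a p} {A : Set a} {P : A → Set p} → ((x : A) → Dec (P x)) → List A → ℕ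
countL P? xs = length (filter P? xs)

isFace : ∀ {n} → List (Subset n) → Subset n → Set
isFace facets s = Any (s ⊆_) facets

isFace? : ∀ {n} (facets : List (Subset n)) (s : Subset n) → Dec (isFace facets s)
isFace? facets s = any? (s ⊆?_) facets

-- f_{i-1}: number of faces with exactly i vertices (i = 0 gives the empty face)
faceCount : ∀ {n} → List (Subset n) → ℕ → ℕ
faceCount {n} facets i =
  countL (λ s → (∣ s ∣ ℕ.≟ i) ×-dec isFace? facets s) (allSubsets n)

sumTo : ℕ → (ℕ → ℤ) → ℤ
sumTo k f = foldr (λ i acc → f i ℤ.+ acc) (+ 0) (upTo (suc k))

sign : ℕ → ℤ
sign zero = + 1
sign (suc m) = - sign m

hVec : ∀ {n} → (d : ℕ) → List (Subset n) → ℕ → ℤ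
hVec d facets k =
  sumTo k (λ i → sign (k ∸ i) ℤ.* (+ ((suc d ∸ i) C (k ∸ i))) ℤ.* (+ faceCount facets i))

dis : ∀ {n} → Subset n → Subset n → ℕ
dis F G = ∣ F ─ G ∣

IsStrongShellingOrder : ∀ {n} → List (Subset n) → Set
IsStrongShellingOrder L =
  ∀ (i j : Fin (length L)) → i Fin.< j →
    Σ (Fin (length L)) λ k → k Fin.< j ×
      (dis (lookup L j) (lookup L k) ≡ 1 ×
      ((lookup L j ─ lookup L k) ⊆ (lookup L j ─ lookup L i) ×
      (lookup L k ─ lookup L j) ⊆ lookup L i))

StronglyShellable : ∀ {n} → List (Subset n) → Set
StronglyShellable facets =
  Σ (List _) λ L → L ↭ facets × IsStrongShellingOrder L

-- h-assignments: a value A(F) for each facet, given as a list aligned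
-- with the facet list.

IsHAssignment : ∀ {n} → (d : ℕ) → (facets : List (Subset n)) → List ℕ → Set
IsHAssignment d facets A =
  length A ≡ length facets ×
  (∀ (F : Fin (length A)) → lookup A F ≤ suc d) ×
  (∀ (i : ℕ) → i ≤ suc d → + countL (ℕ._≟ i) A ≡ hVec d facets i)

-- Candidate facets.  The current complex Δ' together with the current
-- assignment is a list of (facet, value) pairs.

Marked : ℕ → Set
Marked n = List (Subset n × ℕ)

facetsOf : ∀ {n} → Marked n → List (Subset n)
facetsOf = map proj₁

containing : ∀ {n} → List (Subset n) → Subset n → ℕ
containing facets s = countL (s ⊆?_) facets

boundaryRidgesIn : ∀ {n} → ℕ → List (Subset n) → Subset n → ℕ
boundaryRidgesIn {n} d facets F =
  countL (λ s → (∣ s ∣ ℕ.≟ d) ×-dec ((s ⊆? F) ×-dec (containing facets s ℕ.≟ 1)))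
         (allSubsets n)

IsCandidate : ∀ {n} → ℕ → (Δ' : Marked n) → Fin (length Δ') → Set
IsCandidate d Δ' p =
  boundaryRidgesIn d (facetsOf Δ') (proj₁ (lookup Δ' p)) ≡ suc d ∸ proj₂ (lookup Δ' p)

IsStrongCandidate : ∀ {n} → ℕ → (Δ' : Marked n) → Fin (length Δ') → Set
IsStrongCandidate d Δ' p =
  IsCandidate d Δ' p ×
  (∀ (q : Fin (length Δ')) → proj₁ (lookup Δ' q) ≢ F →
     Σ (Fin (length Δ')) λ r →
       dis F (proj₁ (lookup Δ' r)) ≡ 1 ×
       dis (proj₁ (lookup Δ' q)) (proj₁ (lookup Δ' r)) ≡ dis (proj₁ (lookup Δ' q)) F ∸ 1)
  where F = proj₁ (lookup Δ' p)

data StronglyRemovable {n} (d : ℕ) : Marked n → Set where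
  done : StronglyRemovable d []
  step : ∀ (Δ' : Marked n) (p : Fin (length Δ')) →
         IsStrongCandidate d Δ' p →
         StronglyRemovable d (removeAt Δ' p) →
         StronglyRemovable d Δ'

module Submission where

-- Along a strong shelling F₁, …, F_t, the faces that F_j adds to the complex generated by
-- F₁, …, F_{j-1} form the Boolean interval [R_j, F_j], where the restriction face R_j consists
-- of the vertices v of F_j with F_j - v already present. An interval [R, F] contributes exactly
-- one to h_{∣R∣} and nothing to the other entries of the h-vector, so A(F_j) = ∣R_j∣ is an
-- h-assignment. Within F₁, …, F_j the boundary ridges in F_j are the d + 1 - ∣R_j∣ ridges of
-- F_j containing R_j, so F_j is a candidate facet, and for facets of equal size the exchange
-- condition of a strong shelling, with dis(F, H) = 1, says exactly that dis(G, H) =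
-- dis(G, F) - 1. Hence the facets can be removed in the order F_t, …, F₁, and conversely any
-- sequence of strong candidate removals, reversed, is a strong shelling order.

open import Defs
open import Data.Bool using (true)
open import Data.Empty using (⊥-elim)
open import Data.Fin as Fin using (Fin; zero; suc; toℕ)
open import Data.Fin.Subset
  using (Subset; Side; inside; outside; _∈_; _∉_; _⊆_; _─_; _-_; _∩_; ∣_∣; Nonempty; Empty; ⁅_⁆)
open import Data.Fin.Subset.Properties
  using ( _∈?_; _⊆?_; ⊆-trans; ⊆-antisym; drop-∷-⊆; out⊆; in⊆in; p⊆q⇒∣p∣≤∣q∣; nonempty?
        ; Empty-unique; ∣⊥∣≡0; x∈⁅x⁆; x∈⁅y⁆⇒x≡y; ∣⁅x⁆∣≡1; x∈p∧x≢y⇒x∈p-y; x∈p∧x∉q⇒x∈p─q; p─q⊆p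
        ; x∈p∩q⁺; x∈p∩q⁻; ∣p∩q∣≤∣q∣; ∩-comm)
open import Data.List as List
  using (List; []; _∷_; applyUpTo; foldr; _++_; map; filter; length; lookup; removeAt; zip; reverse; take; _ʳ++_)
open import Data.List.Properties
  using (length-map; length-++; reverse-involutive; filter-++; filter-accept; filter-≐; filter-some; filter-none)
open import Data.List.Relation.Unary.All as All using (All; []; _∷_)
open import Data.List.Relation.Unary.All.Properties using (¬Any⇒All¬)
open import Data.List.Relation.Unary.Unique.Propositional using (Unique)
open import Data.List.Relation.Unary.AllPairs using (_∷_)
open import Data.List.Relation.Unary.Any as Any using (Any; here; there)
open import Data.List.Relation.Unary.Any.Properties as Any using (lookup-index)
open import Data.List.Membership.Propositional using (find; lose) renaming (_∈_ to _∈ₗ_)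
open import Data.List.Membership.Propositional.Properties using (∈-map⁺; ∈-lookup)
import Data.List.Relation.Binary.Permutation.Setoid.Properties as Permutationₛ
open import Data.List.Relation.Binary.Permutation.Propositional
  using (_↭_; ↭⇒↭ₛ; ↭-refl; ↭-sym; ↭-trans; ↭-prep; ↭-swap)
open import Data.List.Relation.Binary.Permutation.Propositional.Properties
  using ( Any-resp-↭; All-resp-↭; ∈-resp-↭; ↭-length; filter-↭; drop-∷; ↭-empty-inv; map⁺; ↭-map-inv
        ; ↭-reverse)
open import Data.Nat as ℕ using (ℕ; zero; suc; _+_; _*_; _!; NonZero; _∸_; _≤_; _<_; s≤s; z≤n; s≤s⁻¹)
open import Data.Integer as ℤ using (ℤ; +_; -_)
import Data.Integer.Properties as ℤ
open import Data.Integer.Tactic.RingSolver using (solve-∀)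
open import Data.Nat.Tactic.RingSolver using () renaming (solve-∀ to ℕ-solve-∀)
open import Data.Nat.Combinatorics
  using (_C_; nCk+nC[k+1]≡[n+1]C[k+1]; k>n⇒nCk≡0; k![n∸k]!∣n!; nCk≡nC[n∸k]; nC1≡n)
open import Data.Nat.Combinatorics.Specification using (nCk≡n!/k![n-k]!)
open import Data.Nat.DivMod using (m/n*n≡m)
open import Data.Nat.Properties as ℕ
  using ( suc-injective; 0≢1+n; <⇒≢; ≤-trans; n≤1+n; n<1+n; n≤0⇒n≡0; +-suc; +-identityʳ; +-cancelˡ-≡
        ; m+n∸n≡m; 0∸n≡0; ∸-monoˡ-≤; *-cancelʳ-≡; m*n≢0; _!≢0; _!*_!≢0)
open import Data.Vec.Base as Vec using ([]; _∷_; here; there; tabulate)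
open import Data.Vec.Properties using ([]=⇒lookup; lookup⇒[]=; lookup∘tabulate)
open import Data.Product using (Σ; ∃; _×_; _,_; proj₁; proj₂)
open import Data.Sum using (_⊎_; inj₁; inj₂)
open import Function using (_∘_)
open import Function.Bundles using (_⇔_; mk⇔; Equivalence)
open import Function.Properties.Equivalence using () renaming (refl to ⇔-refl)
open import Relation.Nullary using (¬_; Dec; yes; no; does; contradiction)
open import Relation.Nullary.Decidable using (_×-dec_; ¬?; dec-true)
open import Relation.Unary using (Pred; Decidable; _≐_)
open import Relation.Binary.PropositionalEquality

open Equivalence using (to; from)

private variable n : ℕ

module _ {a p q} {A : Set a} {P : Pred A p} {Q : Pred A q} (P? : Decidable P) (Q? : Decidable Q) where

  countL-cong : P ≐ Q → ∀ xs → countL P? xs ≡ countL Q? xs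
  countL-cong P≐Q xs = cong length (filter-≐ P? Q? P≐Q xs)

  countL-split : ∀ xs →
    countL P? xs ≡ countL (λ x → P? x ×-dec Q? x) xs + countL (λ x → P? x ×-dec ¬? (Q? x)) xs
  countL-split [] = refl
  countL-split (x ∷ xs) with P? x | Q? x
  ... | yes _ | yes _ = cong suc (countL-split xs)
  ... | yes _ | no _  = trans (cong suc (countL-split xs)) (sym (+-suc _ _))
  ... | no _  | _     = countL-split xs

module _ {a p} {A : Set a} {P : Pred A p} (P? : Decidable P) where

  countL-++ : ∀ xs ys → countL P? (xs ++ ys) ≡ countL P? xs + countL P? ys
  countL-++ xs ys = trans (cong length (filter-++ P? xs ys)) (length-++ (filter P? xs))

  countL-↭ : ∀ {xs ys} → xs ↭ ys → countL P? xs ≡ countL P? ys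
  countL-↭ xs↭ys = ↭-length (filter-↭ P? xs↭ys)

  countL≡0⇒¬Any : ∀ xs → countL P? xs ≡ 0 → ¬ Any P xs
  countL≡0⇒¬Any xs c≡0 any = <⇒≢ (filter-some P? any) (sym c≡0)

  ¬Any⇒countL≡0 : ∀ xs → ¬ Any P xs → countL P? xs ≡ 0
  ¬Any⇒countL≡0 xs ¬any = cong length (filter-none P? (¬Any⇒All¬ xs ¬any))

  countL-none : (∀ {x} → ¬ P x) → ∀ xs → countL P? xs ≡ 0
  countL-none ¬P xs = cong length (filter-none P? (All.universal (λ _ → ¬P) xs))

  countL-map : ∀ {b} {B : Set b} (f : B → A) xs → countL P? (map f xs) ≡ countL (P? ∘ f) xs
  countL-map f [] = refl
  countL-map f (x ∷ xs) with P? (f x)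
  ... | yes _ = cong suc (countL-map f xs)
  ... | no _  = countL-map f xs

module _ {a} {A : Set a} where

  ↭-lookup-removeAt : (xs : List A) (p : Fin (length xs)) → xs ↭ lookup xs p ∷ removeAt xs p
  ↭-lookup-removeAt (x ∷ xs) zero    = ↭-refl
  ↭-lookup-removeAt (x ∷ xs) (suc p) = ↭-trans (↭-prep x (↭-lookup-removeAt xs p)) (↭-swap x _ ↭-refl)

  ∈-map⇒lookup : ∀ {b} {B : Set b} {f : A → B} {y} (xs : List A) → y ∈ₗ map f xs →
    ∃ λ p → f (lookup xs p) ≡ y
  ∈-map⇒lookup xs y∈ = let y∈′ = Any.map⁻ y∈ in Any.index y∈′ , sym (lookup-index y∈′)

  ↭-∷⇒removeAt : ∀ {x} (xs ys : List A) → xs ↭ x ∷ ys →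
    ∃ λ p → lookup xs p ≡ x × removeAt xs p ↭ ys
  ↭-∷⇒removeAt {x} xs ys xs↭x∷ys = p , lookup≡x , drop-∷ (↭-trans (↭-sym xs↭lookup∷) xs↭x∷ys)
    where
    x∈xs = ∈-resp-↭ (↭-sym xs↭x∷ys) (here refl)
    p = Any.index x∈xs
    lookup≡x : lookup xs p ≡ x
    lookup≡x = sym (lookup-index x∈xs)
    xs↭lookup∷ : xs ↭ x ∷ removeAt xs p
    xs↭lookup∷ = subst (λ z → xs ↭ z ∷ removeAt xs p) lookup≡x (↭-lookup-removeAt xs p)

Unique-resp-↭ : ∀ {a} {A : Set a} {xs ys : List A} → xs ↭ ys → Unique xs → Unique ys
Unique-resp-↭ {A = A} xs↭ys = Permutationₛ.Unique-resp-↭ (setoid A) (↭⇒↭ₛ xs↭ys)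

module _ {a b} {A : Set a} {B : Set b} where

  zip-map-proj : (Z : List (A × B)) → zip (map proj₁ Z) (map proj₂ Z) ≡ Z
  zip-map-proj []      = refl
  zip-map-proj (z ∷ Z) = cong (z ∷_) (zip-map-proj Z)

  map-proj₁-zip : (xs : List A) (ys : List B) → length ys ≡ length xs → map proj₁ (zip xs ys) ≡ xs
  map-proj₁-zip []       ys       _ = refl
  map-proj₁-zip (x ∷ xs) (y ∷ ys) e = cong (x ∷_) (map-proj₁-zip xs ys (suc-injective e))

-- Subsets and the distance of facets

x∈p─q⇒x∉q : ∀ {x : Fin n} (p q : Subset n) → x ∈ p ─ q → x ∉ q
x∈p─q⇒x∉q (_ ∷ p) (outside ∷ q) (there x∈p─q) (there x∈q) = x∈p─q⇒x∉q p q x∈p─q x∈q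
x∈p─q⇒x∉q (_ ∷ p) (inside ∷ q)  (there x∈p─q) (there x∈q) = x∈p─q⇒x∉q p q x∈p─q x∈q

x∈p⇒1≤∣p∣ : ∀ {x : Fin n} {p} → x ∈ p → 1 ≤ ∣ p ∣
x∈p⇒1≤∣p∣ {x = x} x∈p =
  subst (_≤ _) (∣⁅x⁆∣≡1 x) 
    (p⊆q⇒∣p∣≤∣q∣ λ y∈⁅x⁆ → subst (_∈ _) (sym (x∈⁅y⁆⇒x≡y x y∈⁅x⁆)) x∈p)

Empty⇒∣p∣≡0 : {p : Subset n} → Empty p → ∣ p ∣ ≡ 0
Empty⇒∣p∣≡0 {n} e = trans (cong ∣_∣ (Empty-unique e)) (∣⊥∣≡0 n)

∣p∣≡0⇒Empty : {p : Subset n} → ∣ p ∣ ≡ 0 → Empty p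
∣p∣≡0⇒Empty ∣p∣≡0 (x , x∈p) = contradiction ∣p∣≡0 (<⇒≢ (x∈p⇒1≤∣p∣ x∈p) ∘ sym)

∣p∣≡suc⇒Nonempty : ∀ {m} (p : Subset n) → ∣ p ∣ ≡ suc m → Nonempty p
∣p∣≡suc⇒Nonempty (inside ∷ p)  _ = zero , here
∣p∣≡suc⇒Nonempty (outside ∷ p) e with x , x∈p ← ∣p∣≡suc⇒Nonempty p e = suc x , there x∈p

∣p∣≡1⇒∈-unique : ∀ (p : Subset n) {x y} → ∣ p ∣ ≡ 1 → x ∈ p → y ∈ p → x ≡ y
∣p∣≡1⇒∈-unique (inside ∷ p)  _ here      here      = refl
∣p∣≡1⇒∈-unique (inside ∷ p)  e here      (there y) = ⊥-elim (∣p∣≡0⇒Empty (suc-injective e) (_ , y))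
∣p∣≡1⇒∈-unique (inside ∷ p)  e (there x) _         = ⊥-elim (∣p∣≡0⇒Empty (suc-injective e) (_ , x))
∣p∣≡1⇒∈-unique (outside ∷ p) e (there x) (there y) = cong suc (∣p∣≡1⇒∈-unique p e x y)

Empty-─⇒⊆ : {p q : Subset n} → Empty (p ─ q) → p ⊆ q
Empty-─⇒⊆ {q = q} e {x} x∈p with x ∈? q
... | yes x∈q = x∈q
... | no  x∉q = contradiction (x , x∈p∧x∉q⇒x∈p─q x∈p x∉q) e

⊈⇒Nonempty-─ : {p q : Subset n} → ¬ p ⊆ q → Nonempty (p ─ q)
⊈⇒Nonempty-─ {p = p} {q} p⊈q with nonempty? (p ─ q)
... | yes ne = ne
... | no  e  = ⊥-elim (p⊈q (Empty-─⇒⊆ e))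

∣p∩q∣+∣q─p∣≡∣q∣ : ∀ (p q : Subset n) → ∣ p ∩ q ∣ + ∣ q ─ p ∣ ≡ ∣ q ∣
∣p∩q∣+∣q─p∣≡∣q∣ []            []            = refl
∣p∩q∣+∣q─p∣≡∣q∣ (inside ∷ p)  (inside ∷ q)  = cong suc (∣p∩q∣+∣q─p∣≡∣q∣ p q)
∣p∩q∣+∣q─p∣≡∣q∣ (inside ∷ p)  (outside ∷ q) = ∣p∩q∣+∣q─p∣≡∣q∣ p q
∣p∩q∣+∣q─p∣≡∣q∣ (outside ∷ p) (inside ∷ q)  =
  trans (+-suc _ _) (cong suc (∣p∩q∣+∣q─p∣≡∣q∣ p q))
∣p∩q∣+∣q─p∣≡∣q∣ (outside ∷ p) (outside ∷ q) = ∣p∩q∣+∣q─p∣≡∣q∣ p q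

q⊆p⇒∣p∩q∣≡∣q∣ : ∀ (p q : Subset n) → q ⊆ p → ∣ p ∩ q ∣ ≡ ∣ q ∣
q⊆p⇒∣p∩q∣≡∣q∣ p q q⊆p = begin
  ∣ p ∩ q ∣             ≡⟨ sym (+-identityʳ _) ⟩
  ∣ p ∩ q ∣ + 0         ≡⟨ cong (λ a → ∣ p ∩ q ∣ + a) (sym (Empty⇒∣p∣≡0 q─p-empty)) ⟩
  ∣ p ∩ q ∣ + ∣ q ─ p ∣ ≡⟨ ∣p∩q∣+∣q─p∣≡∣q∣ p q ⟩
  ∣ q ∣                 ∎
  where
  open ≡-Reasoning
  q─p-empty : Empty (q ─ p)
  q─p-empty (x , x∈q─p) = x∈p─q⇒x∉q q p x∈q─p (q⊆p (p─q⊆p q p x∈q─p))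

∣p∩q∣≡∣q∣⇒q⊆p : ∀ (p q : Subset n) → ∣ p ∩ q ∣ ≡ ∣ q ∣ → q ⊆ p
∣p∩q∣≡∣q∣⇒q⊆p p q e = Empty-─⇒⊆ (∣p∣≡0⇒Empty (+-cancelˡ-≡ ∣ p ∩ q ∣ _ _
  (trans (∣p∩q∣+∣q─p∣≡∣q∣ p q) (trans (sym e) (sym (+-identityʳ _))))))

∣p∩q∣≡0⇒∉ : ∀ (p q : Subset n) → ∣ p ∩ q ∣ ≡ 0 → ∀ {x} → x ∈ q → x ∉ p
∣p∩q∣≡0⇒∉ p q e x∈q x∈p = ∣p∣≡0⇒Empty e (_ , x∈p∩q⁺ (x∈p , x∈q))

dis-sym : (F G : Subset n) → ∣ F ∣ ≡ ∣ G ∣ → dis F G ≡ dis G F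
dis-sym F G ∣F∣≡∣G∣ = +-cancelˡ-≡ ∣ G ∩ F ∣ _ _ (begin
  ∣ G ∩ F ∣ + ∣ F ─ G ∣ ≡⟨ ∣p∩q∣+∣q─p∣≡∣q∣ G F ⟩
  ∣ F ∣                 ≡⟨ ∣F∣≡∣G∣ ⟩
  ∣ G ∣                 ≡⟨ ∣p∩q∣+∣q─p∣≡∣q∣ F G ⟨
  ∣ F ∩ G ∣ + ∣ G ─ F ∣ ≡⟨ cong (λ s → ∣ s ∣ + ∣ G ─ F ∣) (∩-comm F G) ⟩
  ∣ G ∩ F ∣ + ∣ G ─ F ∣ ∎)
  where open ≡-Reasoning

dis-refl : (F : Subset n) → dis F F ≡ 0
dis-refl F = Empty⇒∣p∣≡0 λ (x , x∈F─F) → x∈p─q⇒x∉q F F x∈F─F (p─q⊆p F F x∈F─F)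

dis≡0⇒⊆ : (F G : Subset n) → dis F G ≡ 0 → F ⊆ G
dis≡0⇒⊆ F G e = Empty-─⇒⊆ (∣p∣≡0⇒Empty e)

-- Replacing the reference facet F by H changes the distance from G by the
-- vertices of G gained in H ─ F minus those lost in F ─ H.
dis-exchange : (G F H : Subset n) → dis G H + ∣ G ∩ (H ─ F) ∣ ≡ dis G F + ∣ G ∩ (F ─ H) ∣
dis-exchange [] [] [] = refl
dis-exchange (inside ∷ G)  (inside ∷ F)  (inside ∷ H)  = dis-exchange G F H
dis-exchange (inside ∷ G)  (outside ∷ F) (inside ∷ H)  = trans (+-suc _ _) (cong suc (dis-exchange G F H))
dis-exchange (inside ∷ G)  (inside ∷ F)  (outside ∷ H) = trans (cong suc (dis-exchange G F H)) (sym (+-suc _ _))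
dis-exchange (inside ∷ G)  (outside ∷ F) (outside ∷ H) = cong suc (dis-exchange G F H)
dis-exchange (outside ∷ G) (inside ∷ F)  (inside ∷ H)  = dis-exchange G F H
dis-exchange (outside ∷ G) (outside ∷ F) (inside ∷ H)  = dis-exchange G F H
dis-exchange (outside ∷ G) (inside ∷ F)  (outside ∷ H) = dis-exchange G F H
dis-exchange (outside ∷ G) (outside ∷ F) (outside ∷ H) = dis-exchange G F H

-- H is the facet that the strong shelling condition requires for F and an earlier facet G.
ShellingWitness : (F G H : Subset n) → Set
ShellingWitness F G H = dis F H ≡ 1 × F ─ H ⊆ F ─ G × H ─ F ⊆ G

StrongShellingStep : Subset n → (Subset n → Set) → Set
StrongShellingStep F Earlier = ∀ {G} → Earlier G → ∃ λ H → Earlier H × ShellingWitness F G H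

module _ (F G H : Subset n) (∣F∣≡∣H∣ : ∣ F ∣ ≡ ∣ H ∣) (dis≡1 : dis F H ≡ 1) where

  private
    dis-H-F≡1 : dis H F ≡ 1
    dis-H-F≡1 = trans (sym (dis-sym F H ∣F∣≡∣H∣)) dis≡1

  witness⇒dis-pred : F ─ H ⊆ F ─ G → H ─ F ⊆ G → dis G H ≡ dis G F ∸ 1
  witness⇒dis-pred F─H⊆F─G H─F⊆G = begin
    dis G H                           ≡⟨ m+n∸n≡m (dis G H) 1 ⟨
    dis G H + 1 ∸ 1                   ≡⟨ cong (λ a → dis G H + a ∸ 1) gained ⟨
    dis G H + ∣ G ∩ (H ─ F) ∣ ∸ 1     ≡⟨ cong (_∸ 1) (dis-exchange G F H) ⟩
    dis G F + ∣ G ∩ (F ─ H) ∣ ∸ 1     ≡⟨ cong (λ a → dis G F + a ∸ 1) lost ⟩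
    dis G F + 0 ∸ 1                   ≡⟨ cong (_∸ 1) (+-identityʳ (dis G F)) ⟩
    dis G F ∸ 1                       ∎
    where
    open ≡-Reasoning
    gained : ∣ G ∩ (H ─ F) ∣ ≡ 1
    gained = trans (q⊆p⇒∣p∩q∣≡∣q∣ G (H ─ F) H─F⊆G) dis-H-F≡1
    lost : ∣ G ∩ (F ─ H) ∣ ≡ 0
    lost = Empty⇒∣p∣≡0 λ (x , x∈G∩F─H) →
      let x∈G , x∈F─H = x∈p∩q⁻ G (F ─ H) x∈G∩F─H
      in  x∈p─q⇒x∉q F G (F─H⊆F─G x∈F─H) x∈G

  dis-pred⇒witness : ∣ G ∣ ≡ ∣ F ∣ → G ≢ F → dis G H ≡ dis G F ∸ 1 → ShellingWitness F G H
  dis-pred⇒witness ∣G∣≡∣F∣ G≢F dis-pred with dis G F in dis-G-F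
  ... | zero = contradiction (⊆-antisym (dis≡0⇒⊆ G F dis-G-F)
                 (dis≡0⇒⊆ F G (trans (dis-sym F G (sym ∣G∣≡∣F∣)) dis-G-F))) G≢F
  ... | suc m = dis≡1 , F─H⊆F─G , ∣p∩q∣≡∣q∣⇒q⊆p G (H ─ F) (trans gained≡1 (sym dis-H-F≡1))
    where
    exchange : m + ∣ G ∩ (H ─ F) ∣ ≡ suc m + ∣ G ∩ (F ─ H) ∣
    exchange = trans (cong (_+ ∣ G ∩ (H ─ F) ∣) (sym dis-pred))
                     (trans (dis-exchange G F H) (cong (_+ ∣ G ∩ (F ─ H) ∣) dis-G-F))
    gained≡suc-lost : ∣ G ∩ (H ─ F) ∣ ≡ suc ∣ G ∩ (F ─ H) ∣
    gained≡suc-lost = +-cancelˡ-≡ m _ _ (trans exchange (sym (+-suc m _)))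
    gained≤1 : ∣ G ∩ (H ─ F) ∣ ≤ 1
    gained≤1 = subst (∣ G ∩ (H ─ F) ∣ ≤_) dis-H-F≡1 (∣p∩q∣≤∣q∣ G (H ─ F))
    lost≡0 : ∣ G ∩ (F ─ H) ∣ ≡ 0
    lost≡0 = n≤0⇒n≡0 (s≤s⁻¹ (subst (_≤ 1) gained≡suc-lost gained≤1))
    gained≡1 : ∣ G ∩ (H ─ F) ∣ ≡ 1
    gained≡1 = trans gained≡suc-lost (cong suc lost≡0)
    F─H⊆F─G : F ─ H ⊆ F ─ G
    F─H⊆F─G x∈F─H =
      x∈p∧x∉q⇒x∈p─q (p─q⊆p F H x∈F─H) (∣p∩q∣≡0⇒∉ G (F ─ H) lost≡0 x∈F─H)

-- Counting the faces of an interval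

InInterval : Subset n → Subset n → ℕ → Pred (Subset n) _
InInterval R F i s = ∣ s ∣ ≡ i × s ⊆ F × R ⊆ s

inInterval? : (R F : Subset n) (i : ℕ) → Decidable (InInterval R F i)
inInterval? R F i s = (∣ s ∣ ℕ.≟ i) ×-dec ((s ⊆? F) ×-dec (R ⊆? s))

intervalCount : Subset n → Subset n → ℕ → ℕ
intervalCount {n} R F i = countL (inInterval? R F i) (allSubsets n)

-- The number of i-sets between a fixed r-set and a fixed m-set containing it,
-- that is (m ∸ r) C (i ∸ r) for r ≤ i and 0 otherwise.
intervalSize : ℕ → ℕ → ℕ → ℕ
intervalSize m       zero    i       = m C i
intervalSize zero    (suc r) i       = 0
intervalSize (suc m) (suc r) zero    = 0
intervalSize (suc m) (suc r) (suc i) = intervalSize m r i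

intervalSize-zero : ∀ m r → r ≤ m → intervalSize (suc m) r 0 ≡ intervalSize m r 0
intervalSize-zero m       zero    _ = refl
intervalSize-zero (suc m) (suc r) _ = refl

intervalSize-pascal : ∀ m r i → r ≤ m →
  intervalSize (suc m) r (suc i) ≡ intervalSize m r i + intervalSize m r (suc i)
intervalSize-pascal m       zero    i       _         = sym (nCk+nC[k+1]≡[n+1]C[k+1] m i)
intervalSize-pascal (suc m) (suc r) zero    (s≤s r≤m) = intervalSize-zero m r r≤m
intervalSize-pascal (suc m) (suc r) (suc i) (s≤s r≤m) = intervalSize-pascal m r i r≤m

intervalSize-ridge : ∀ d r → r ≤ suc d → intervalSize (suc d) r d ≡ suc d ∸ r
intervalSize-ridge d       zero    _         =
  trans (nCk≡nC[n∸k] (n≤1+n d)) (trans (cong (suc d C_) (m+n∸n≡m 1 d)) (nC1≡n (suc d)))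
intervalSize-ridge zero    (suc r) _         = sym (0∸n≡0 r)
intervalSize-ridge (suc d) (suc r) (s≤s r≤d) = intervalSize-ridge d r r≤d

intervalCountAt : Side → Subset (suc n) → Subset (suc n) → ℕ → ℕ
intervalCountAt {n} z R F i = countL (inInterval? R F i ∘ (z ∷_)) (allSubsets n)

intervalCount-split : (R F : Subset (suc n)) (i : ℕ) →
  intervalCount R F i ≡ intervalCountAt inside R F i + intervalCountAt outside R F i
intervalCount-split {n} R F i = trans (countL-++ P? (map (inside ∷_) (allSubsets n)) _)
  (cong₂ _+_ (countL-map P? (inside ∷_) (allSubsets n)) (countL-map P? (outside ∷_) (allSubsets n)))
  where P? = inInterval? R F i

zero∉outside∷ : {p : Subset n} → zero ∉ outside ∷ p
zero∉outside∷ ()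

module _ (R F : Subset n) where

  private
    intervalCountAt-∷ : ∀ x y z i j → (∀ {s : Subset n} → ∣ s ∣ ≡ j ⇔ ∣ z ∷ s ∣ ≡ i) →
      (∀ {s} → s ⊆ F → z ∷ s ⊆ y ∷ F) → (∀ {s} → R ⊆ s → x ∷ R ⊆ z ∷ s) →
      intervalCountAt z (x ∷ R) (y ∷ F) i ≡ intervalCount R F j
    intervalCountAt-∷ x y z i j size lift-F lift-R =
      sym (countL-cong (inInterval? R F j) (inInterval? (x ∷ R) (y ∷ F) i ∘ (z ∷_))
        ( (λ {s} (e , s⊆F , R⊆s) → to (size {s}) e , lift-F s⊆F , lift-R R⊆s)
        , (λ {s} (e , s⊆F , R⊆s) → from (size {s}) e , drop-∷-⊆ s⊆F , drop-∷-⊆ R⊆s))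
        (allSubsets n))

    intervalCountAt-∷≡0 : ∀ x y z i → (∀ {s} → ¬ InInterval (x ∷ R) (y ∷ F) i (z ∷ s)) →
      intervalCountAt z (x ∷ R) (y ∷ F) i ≡ 0
    intervalCountAt-∷≡0 x y z i ¬I =
      countL-none (inInterval? (x ∷ R) (y ∷ F) i ∘ (z ∷_)) ¬I (allSubsets n)

  intervalCountAt-inside : ∀ x i → (∀ {s} → R ⊆ s → x ∷ R ⊆ inside ∷ s) →
    intervalCountAt inside (x ∷ R) (inside ∷ F) (suc i) ≡ intervalCount R F i
  intervalCountAt-inside x i =
    intervalCountAt-∷ x inside inside (suc i) i (mk⇔ (cong ℕ.suc) suc-injective) in⊆in

  intervalCountAt-outside : ∀ y i → intervalCountAt outside (outside ∷ R) (y ∷ F) i ≡ intervalCount R F i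
  intervalCountAt-outside y i = intervalCountAt-∷ outside y outside i i ⇔-refl out⊆ out⊆

  intervalCountAt-inside-outsideF≡0 : ∀ x i → intervalCountAt inside (x ∷ R) (outside ∷ F) i ≡ 0
  intervalCountAt-inside-outsideF≡0 x i =
    intervalCountAt-∷≡0 x outside inside i λ (_ , s⊆F , _) → zero∉outside∷ (s⊆F here)

  intervalCountAt-inside-zero≡0 : ∀ x y → intervalCountAt inside (x ∷ R) (y ∷ F) 0 ≡ 0
  intervalCountAt-inside-zero≡0 x y = intervalCountAt-∷≡0 x y inside 0 λ ()

  intervalCountAt-outside-insideR≡0 : ∀ y i → intervalCountAt outside (inside ∷ R) (y ∷ F) i ≡ 0
  intervalCountAt-outside-insideR≡0 y i =
    intervalCountAt-∷≡0 inside y outside i λ (_ , _ , R⊆s) → zero∉outside∷ (R⊆s here)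

intervalCount≡intervalSize : (R F : Subset n) → R ⊆ F →
  ∀ i → intervalCount R F i ≡ intervalSize ∣ F ∣ ∣ R ∣ i
intervalCount≡intervalSize [] [] _ zero    = refl
intervalCount≡intervalSize [] [] _ (suc i) = refl
intervalCount≡intervalSize (inside ∷ R) (outside ∷ F) R⊆F i with () ← R⊆F here
intervalCount≡intervalSize (outside ∷ R) (outside ∷ F) R⊆F i =
  trans (intervalCount-split (outside ∷ R) (outside ∷ F) i)
        (cong₂ _+_ (intervalCountAt-inside-outsideF≡0 R F outside i)
                   (trans (intervalCountAt-outside R F outside i) (intervalCount≡intervalSize R F R⊆F′ i)))
  where R⊆F′ = drop-∷-⊆ R⊆F
intervalCount≡intervalSize (inside ∷ R) (inside ∷ F) R⊆F zero =
  trans (intervalCount-split (inside ∷ R) (inside ∷ F) 0)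
        (cong₂ _+_ (intervalCountAt-inside-zero≡0 R F inside inside)
                   (intervalCountAt-outside-insideR≡0 R F inside 0))
intervalCount≡intervalSize (inside ∷ R) (inside ∷ F) R⊆F (suc i) =
  trans (intervalCount-split (inside ∷ R) (inside ∷ F) (suc i))
        (trans (cong₂ _+_ (intervalCountAt-inside R F inside i in⊆in)
                          (intervalCountAt-outside-insideR≡0 R F inside (suc i)))
               (trans (+-identityʳ _) (intervalCount≡intervalSize R F R⊆F′ i)))
  where R⊆F′ = drop-∷-⊆ R⊆F
intervalCount≡intervalSize (outside ∷ R) (inside ∷ F) R⊆F zero =
  trans (intervalCount-split (outside ∷ R) (inside ∷ F) 0)
        (trans (cong₂ _+_ (intervalCountAt-inside-zero≡0 R F outside inside)
                          (intervalCountAt-outside R F inside 0))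
               (trans (intervalCount≡intervalSize R F R⊆F′ 0)
                      (sym (intervalSize-zero ∣ F ∣ ∣ R ∣ (p⊆q⇒∣p∣≤∣q∣ R⊆F′)))))
  where R⊆F′ = drop-∷-⊆ R⊆F
intervalCount≡intervalSize (outside ∷ R) (inside ∷ F) R⊆F (suc i) =
  trans (intervalCount-split (outside ∷ R) (inside ∷ F) (suc i))
        (trans (cong₂ _+_ (intervalCountAt-inside R F outside i out⊆)
                          (intervalCountAt-outside R F inside (suc i)))
               (trans (cong₂ _+_ (intervalCount≡intervalSize R F R⊆F′ i)
                                 (intervalCount≡intervalSize R F R⊆F′ (suc i)))
                      (sym (intervalSize-pascal ∣ F ∣ ∣ R ∣ i (p⊆q⇒∣p∣≤∣q∣ R⊆F′)))))
  where R⊆F′ = drop-∷-⊆ R⊆F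

-- Binomial identities and alternating sums

C*!*!≡! : ∀ {n k} → k ≤ n → (n C k) * (k ! * (n ∸ k) !) ≡ n !
C*!*!≡! {n} {k} k≤n = trans (cong (_* (k ! * (n ∸ k) !)) (nCk≡n!/k![n-k]! k≤n))
  (m/n*n≡m {{k !* (n ∸ k) !≢0}} (k![n∸k]!∣n! k≤n))

∸-∸-∸ : ∀ D k i → i ≤ k → k ≤ D → (D ∸ i) ∸ (k ∸ i) ≡ D ∸ k
∸-∸-∸ D       k       zero    _         _         = refl
∸-∸-∸ (suc D) (suc k) (suc i) (s≤s i≤k) (s≤s k≤D) = ∸-∸-∸ D k i i≤k k≤D

-- Both sides count the pairs (an i-set, a k-set containing it) inside a D-set;
-- they are compared after multiplying by i! (k ∸ i)! (D ∸ k)!.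
C*C≡C*C : ∀ D k i → i ≤ k → k ≤ D → ((D ∸ i) C (k ∸ i)) * (D C i) ≡ (D C k) * (k C i)
C*C≡C*C D k i i≤k k≤D = *-cancelʳ-≡ _ _ (a * (b * c)) {{a*[b*c]≢0}} (trans lhs≡D! (sym rhs≡D!))
  where
  open ≡-Reasoning
  a = i !
  b = (k ∸ i) !
  c = (D ∸ k) !
  a*[b*c]≢0 : NonZero (a * (b * c))
  a*[b*c]≢0 = m*n≢0 a (b * c) {{i !≢0}} {{m*n≢0 b c {{(k ∸ i) !≢0}} {{(D ∸ k) !≢0}}}}
  X = (D ∸ i) C (k ∸ i)
  lhs≡D! : X * (D C i) * (a * (b * c)) ≡ D !
  lhs≡D! = begin
    X * (D C i) * (a * (b * c))                  ≡⟨ ℕ-solve X (D C i) a b c ⟩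
    (D C i) * (a * (X * (b * c)))                ≡⟨ cong (λ t → (D C i) * (a * (X * (b * t !))))
                                                         (sym (∸-∸-∸ D k i i≤k k≤D)) ⟩
    (D C i) * (a * (X * (b * ((D ∸ i) ∸ (k ∸ i)) !)))
      ≡⟨ cong (λ t → (D C i) * (a * t)) (C*!*!≡! (∸-monoˡ-≤ i k≤D)) ⟩
    (D C i) * (a * (D ∸ i) !)                    ≡⟨ C*!*!≡! (≤-trans i≤k k≤D) ⟩
    D !                                          ∎
    where ℕ-solve : ∀ x y a b c → x * y * (a * (b * c)) ≡ y * (a * (x * (b * c)))
          ℕ-solve = ℕ-solve-∀
  rhs≡D! : (D C k) * (k C i) * (a * (b * c)) ≡ D !
  rhs≡D! = begin
    (D C k) * (k C i) * (a * (b * c))            ≡⟨ ℕ-solve (D C k) (k C i) a b c ⟩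
    (D C k) * ((k C i) * (a * b) * c)            ≡⟨ cong (λ t → (D C k) * (t * c)) (C*!*!≡! i≤k) ⟩
    (D C k) * (k ! * c)                          ≡⟨ C*!*!≡! k≤D ⟩
    D !                                          ∎
    where ℕ-solve : ∀ x y a b c → x * y * (a * (b * c)) ≡ x * (y * (a * b) * c)
          ℕ-solve = ℕ-solve-∀

∑ : ℕ → (ℕ → ℤ) → ℤ
∑ zero    f = + 0
∑ (suc m) f = f 0 ℤ.+ ∑ m (f ∘ suc)

syntax ∑ m (λ i → e) = ∑[ i < m ] e

foldr-applyUpTo≡∑ : ∀ (f : ℕ → ℤ) h m →
  foldr (λ i acc → f i ℤ.+ acc) (+ 0) (applyUpTo h m) ≡ ∑ m (f ∘ h)
foldr-applyUpTo≡∑ f h zero    = refl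
foldr-applyUpTo≡∑ f h (suc m) = cong (λ t → f (h 0) ℤ.+ t) (foldr-applyUpTo≡∑ f (h ∘ suc) m)

sumTo≡∑ : ∀ k f → sumTo k f ≡ ∑ (suc k) f
sumTo≡∑ k f = foldr-applyUpTo≡∑ f (λ i → i) (suc k)

∑-cong : ∀ m {f g : ℕ → ℤ} → (∀ i → i < m → f i ≡ g i) → ∑ m f ≡ ∑ m g
∑-cong zero    f≡g = refl
∑-cong (suc m) f≡g = cong₂ ℤ._+_ (f≡g 0 (s≤s z≤n)) (∑-cong m λ i i<m → f≡g (suc i) (s≤s i<m))

∑-zero : ∀ m → ∑[ i < m ] (+ 0) ≡ + 0
∑-zero zero    = refl
∑-zero (suc m) = trans (ℤ.+-identityˡ _) (∑-zero m)

∑-+ : ∀ m (f g : ℕ → ℤ) → ∑[ i < m ] (f i ℤ.+ g i) ≡ ∑ m f ℤ.+ ∑ m g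
∑-+ zero    f g = refl
∑-+ (suc m) f g =
  trans (cong (λ t → f 0 ℤ.+ g 0 ℤ.+ t) (∑-+ m (f ∘ suc) (g ∘ suc))) (shuffle (f 0) (g 0) _ _)
  where shuffle : ∀ a b c d → a ℤ.+ b ℤ.+ (c ℤ.+ d) ≡ a ℤ.+ c ℤ.+ (b ℤ.+ d)
        shuffle = solve-∀

∑-*ˡ : ∀ m c (f : ℕ → ℤ) → ∑[ i < m ] (c ℤ.* f i) ≡ c ℤ.* ∑ m f
∑-*ˡ zero    c f = sym (ℤ.*-zeroʳ c)
∑-*ˡ (suc m) c f =
  trans (cong (λ t → c ℤ.* f 0 ℤ.+ t) (∑-*ˡ m c (f ∘ suc))) (sym (ℤ.*-distribˡ-+ c _ _))

∑-neg : ∀ m (f : ℕ → ℤ) → ∑[ i < m ] (- f i) ≡ - ∑ m f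
∑-neg zero    f = refl
∑-neg (suc m) f = trans (cong (λ t → - f 0 ℤ.+ t) (∑-neg m (f ∘ suc))) (sym (ℤ.neg-distrib-+ (f 0) _))

∑-last : ∀ m (f : ℕ → ℤ) → ∑ (suc m) f ≡ ∑ m f ℤ.+ f m
∑-last zero    f = trans (ℤ.+-identityʳ (f 0)) (sym (ℤ.+-identityˡ (f 0)))
∑-last (suc m) f = trans (cong (λ t → f 0 ℤ.+ t) (∑-last m (f ∘ suc))) (sym (ℤ.+-assoc (f 0) _ _))

sign-∸-suc : ∀ k i → i < k → sign (k ∸ i) ≡ - sign (k ∸ suc i)
sign-∸-suc (suc k) zero    _         = refl
sign-∸-suc (suc k) (suc i) (s≤s i<k) = sign-∸-suc k i i<k

∑-sign-C≡0 : ∀ k → ∑[ i < suc (suc k) ] (sign (suc k ∸ i) ℤ.* + (suc k C i)) ≡ + 0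
∑-sign-C≡0 k = begin
  sign (suc k) ℤ.* + 1 ℤ.+ ∑[ i < suc k ] (sign (k ∸ i) ℤ.* + (suc k C suc i))
    ≡⟨ cong (λ t → sign (suc k) ℤ.* + 1 ℤ.+ t)
            (trans (∑-cong (suc k) pascal)
                   (∑-+ (suc k) (λ i → sign (k ∸ i) ℤ.* + (k C i))
                                (λ i → sign (k ∸ i) ℤ.* + (k C suc i)))) ⟩
  sign (suc k) ℤ.* + 1 ℤ.+ (sign k ℤ.* + 1 ℤ.+ Y ℤ.+ ∑[ i < suc k ] (sign (k ∸ i) ℤ.* + (k C suc i)))
    ≡⟨ cong (λ t → sign (suc k) ℤ.* + 1 ℤ.+ (sign k ℤ.* + 1 ℤ.+ Y ℤ.+ t)) shifted≡-Y ⟩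
  - sign k ℤ.* + 1 ℤ.+ (sign k ℤ.* + 1 ℤ.+ Y ℤ.+ - Y)
    ≡⟨ cancel (sign k) Y ⟩
  + 0 ∎
  where
  open ≡-Reasoning
  Y = ∑[ i < k ] (sign (k ∸ suc i) ℤ.* + (k C suc i))
  pascal : ∀ i → i < suc k → sign (k ∸ i) ℤ.* + (suc k C suc i)
                           ≡ sign (k ∸ i) ℤ.* + (k C i) ℤ.+ sign (k ∸ i) ℤ.* + (k C suc i)
  pascal i _ = trans (cong (λ c → sign (k ∸ i) ℤ.* + c) (sym (nCk+nC[k+1]≡[n+1]C[k+1] k i)))
                     (ℤ.*-distribˡ-+ (sign (k ∸ i)) (+ (k C i)) (+ (k C suc i)))
  shifted≡-Y : ∑[ i < suc k ] (sign (k ∸ i) ℤ.* + (k C suc i)) ≡ - Y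
  shifted≡-Y = begin
    ∑[ i < suc k ] (sign (k ∸ i) ℤ.* + (k C suc i))
      ≡⟨ ∑-last k _ ⟩
    ∑[ i < k ] (sign (k ∸ i) ℤ.* + (k C suc i)) ℤ.+ sign (k ∸ k) ℤ.* + (k C suc k)
      ≡⟨ cong₂ (λ s c → s ℤ.+ sign (k ∸ k) ℤ.* + c) (∑-cong k negate) (k>n⇒nCk≡0 (n<1+n k)) ⟩
    ∑[ i < k ] (- (sign (k ∸ suc i) ℤ.* + (k C suc i))) ℤ.+ sign (k ∸ k) ℤ.* + 0
      ≡⟨ cong₂ ℤ._+_ (∑-neg k _) (ℤ.*-zeroʳ (sign (k ∸ k))) ⟩
    - Y ℤ.+ + 0
      ≡⟨ ℤ.+-identityʳ (- Y) ⟩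
    - Y ∎
    where
    negate : ∀ i → i < k → sign (k ∸ i) ℤ.* + (k C suc i) ≡ - (sign (k ∸ suc i) ℤ.* + (k C suc i))
    negate i i<k = trans (cong (ℤ._* + (k C suc i)) (sign-∸-suc k i i<k))
                         (sym (ℤ.neg-distribˡ-* (sign (k ∸ suc i)) _))
  cancel : ∀ s y → - s ℤ.* + 1 ℤ.+ (s ℤ.* + 1 ℤ.+ y ℤ.+ - y) ≡ + 0
  cancel = solve-∀

-- Kronecker delta, written as a count so that it adds up with countL (_≟ k) over a list.
δ : ℕ → ℕ → ℕ
δ r k = countL (ℕ._≟ k) (r ∷ [])

δ-suc : ∀ r k → δ (suc r) (suc k) ≡ δ r k
δ-suc r k = trans (countL-map (ℕ._≟ suc k) ℕ.suc (r ∷ []))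
                  (countL-cong ((ℕ._≟ suc k) ∘ ℕ.suc) (ℕ._≟ k) (suc-injective , cong ℕ.suc) (r ∷ []))

-- hTerm (d + 1) k i f_{i-1} is the i-th summand of h_k in the definition of hVec.
hTerm : ℕ → ℕ → ℕ → ℕ → ℤ
hTerm D k i f = sign (k ∸ i) ℤ.* + ((D ∸ i) C (k ∸ i)) ℤ.* + f

∑-hTerm-intervalSize≡δ : ∀ D r k → r ≤ D → k ≤ D →
  ∑[ i < suc k ] hTerm D k i (intervalSize D r i) ≡ + δ r k
∑-hTerm-intervalSize≡δ D zero k _ k≤D =
  trans (∑-cong (suc k) trinomial)
        (trans (∑-*ˡ (suc k) (+ (D C k)) (λ i → sign (k ∸ i) ℤ.* + (k C i))) (alternating k))
  where
  trinomial : ∀ i → i < suc k → hTerm D k i (D C i) ≡ + (D C k) ℤ.* (sign (k ∸ i) ℤ.* + (k C i))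
  trinomial i (s≤s i≤k) = begin
    sign (k ∸ i) ℤ.* + X ℤ.* + (D C i)
      ≡⟨ ℤ.*-assoc (sign (k ∸ i)) (+ X) (+ (D C i)) ⟩
    sign (k ∸ i) ℤ.* (+ X ℤ.* + (D C i))
      ≡⟨ cong (sign (k ∸ i) ℤ.*_) (ℤ.pos-* X (D C i)) ⟨
    sign (k ∸ i) ℤ.* + (X * (D C i))
      ≡⟨ cong (λ c → sign (k ∸ i) ℤ.* + c) (C*C≡C*C D k i i≤k k≤D) ⟩
    sign (k ∸ i) ℤ.* + ((D C k) * (k C i))
      ≡⟨ cong (sign (k ∸ i) ℤ.*_) (ℤ.pos-* (D C k) (k C i)) ⟩
    sign (k ∸ i) ℤ.* (+ (D C k) ℤ.* + (k C i))
      ≡⟨ swap (sign (k ∸ i)) (+ (D C k)) (+ (k C i)) ⟩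
    + (D C k) ℤ.* (sign (k ∸ i) ℤ.* + (k C i)) ∎
    where open ≡-Reasoning
          X = (D ∸ i) C (k ∸ i)
          swap : ∀ a b c → a ℤ.* (b ℤ.* c) ≡ b ℤ.* (a ℤ.* c)
          swap = solve-∀
  alternating : ∀ k → + (D C k) ℤ.* ∑[ i < suc k ] (sign (k ∸ i) ℤ.* + (k C i)) ≡ + δ 0 k
  alternating zero    = refl
  alternating (suc k) = trans (cong (+ (D C suc k) ℤ.*_) (∑-sign-C≡0 k)) (ℤ.*-zeroʳ (+ (D C suc k)))
∑-hTerm-intervalSize≡δ (suc D) (suc r) zero    _         _         =
  trans (ℤ.+-identityʳ _) (ℤ.*-zeroʳ (+ 1 ℤ.* + (suc D C 0)))
∑-hTerm-intervalSize≡δ (suc D) (suc r) (suc k) (s≤s r≤D) (s≤s k≤D) =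
  trans (cong (λ t → t ℤ.+ ∑[ i < suc k ] hTerm D k i (intervalSize D r i))
              (ℤ.*-zeroʳ (sign (suc k) ℤ.* + (suc D C suc k))))
        (trans (ℤ.+-identityˡ _) (trans (∑-hTerm-intervalSize≡δ D r k r≤D k≤D) (cong +_ (sym (δ-suc r k)))))

-- Restriction faces

does≡true⇒ : ∀ {a} {A : Set a} (a? : Dec A) → does a? ≡ true → A
does≡true⇒ (yes a) _ = a

restriction : Subset n → List (Subset n) → Subset n
restriction F Q = tabulate λ v → does (v ∈? F ×-dec isFace? Q (F - v))

module _ (F : Subset n) (Q : List (Subset n)) {v : Fin n} where

  ∈restriction⁻ : v ∈ restriction F Q → v ∈ F × isFace Q (F - v)
  ∈restriction⁻ v∈R = does≡true⇒ (v ∈? F ×-dec isFace? Q (F - v))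
    (trans (sym (lookup∘tabulate _ v)) ([]=⇒lookup v∈R))

  ∈restriction⁺ : v ∈ F → isFace Q (F - v) → v ∈ restriction F Q
  ∈restriction⁺ v∈F face = lookup⇒[]= v _
    (trans (lookup∘tabulate _ v) (dec-true (v ∈? F ×-dec isFace? Q (F - v)) (v∈F , face)))

restriction⊆ : (F : Subset n) (Q : List (Subset n)) → restriction F Q ⊆ F
restriction⊆ F Q = proj₁ ∘ ∈restriction⁻ F Q

isFace-⊆ : ∀ {Q : List (Subset n)} {s t} → s ⊆ t → isFace Q t → isFace Q s
isFace-⊆ s⊆t = Any.map (⊆-trans s⊆t)

⊆-─-singleton : ∀ {F s : Subset n} {v} → s ⊆ F → v ∉ s → s ⊆ F - v
⊆-─-singleton s⊆F v∉s w∈s = x∈p∧x≢y⇒x∈p-y (s⊆F w∈s) λ { refl → v∉s w∈s }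

-- A subset of F that avoids a vertex of the restriction lies in some F - v.
¬isFace⇒restriction⊆ : ∀ {F s : Subset n} {Q} → s ⊆ F → ¬ isFace Q s → restriction F Q ⊆ s
¬isFace⇒restriction⊆ {F = F} {s} {Q} s⊆F ¬face with restriction F Q ⊆? s
... | yes R⊆s = R⊆s
... | no  R⊈s = ⊥-elim (¬face (isFace-⊆ (⊆-─-singleton s⊆F v∉s) F-v-face))
  where
  v,v∈R─s = ⊈⇒Nonempty-─ R⊈s
  v = proj₁ v,v∈R─s
  v∉s = x∈p─q⇒x∉q _ s (proj₂ v,v∈R─s)
  F-v-face = proj₂ (∈restriction⁻ F Q (p─q⊆p _ s (proj₂ v,v∈R─s)))

-- Conversely the strong shelling condition gives, for every face s of Q, a facet H of Q
-- with F ─ H = { v } for a vertex v ∉ s; then F - v ⊆ H, so v lies in the restriction.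
restriction⊆⇒¬isFace : ∀ {F s : Subset n} {Q} → StrongShellingStep F (_∈ₗ Q) →
  restriction F Q ⊆ s → ¬ isFace Q s
restriction⊆⇒¬isFace {F = F} {s} {Q} shelling R⊆s face with find face
... | G , G∈Q , s⊆G with shelling G∈Q
... | H , H∈Q , dis≡1 , F─H⊆F─G , _ with ∣p∣≡suc⇒Nonempty (F ─ H) dis≡1
... | v , v∈F─H =
  x∈p─q⇒x∉q F G (F─H⊆F─G v∈F─H) (s⊆G (R⊆s (∈restriction⁺ F Q (p─q⊆p F H v∈F─H) (lose H∈Q F-v⊆H))))
  where
  F-v⊆H : F - v ⊆ H
  F-v⊆H {w} w∈F-v with w ∈? H
  ... | yes w∈H = w∈H
  ... | no  w∉H = contradiction
    (∣p∣≡1⇒∈-unique (F ─ H) dis≡1 (x∈p∧x∉q⇒x∈p─q (p─q⊆p F ⁅ v ⁆ w∈F-v) w∉H) v∈F─H)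
    (x∈p─q⇒x∉q F ⁅ v ⁆ w∈F-v ∘ λ { refl → x∈⁅x⁆ v })

containing-∷ : ∀ {F s : Subset n} (Q : List (Subset n)) → s ⊆ F →
  containing (F ∷ Q) s ≡ suc (containing Q s)
containing-∷ {s = s} Q s⊆F = cong length (filter-accept (s ⊆?_) {xs = Q} s⊆F)

module _ {F : Subset n} {Q : List (Subset n)} (shelling : StrongShellingStep F (_∈ₗ Q)) where

  private
    R = restriction F Q

  faceCount-∷ : ∀ i → faceCount (F ∷ Q) i ≡ faceCount Q i + intervalCount R F i
  faceCount-∷ i =
    trans (countL-split (λ s → (∣ s ∣ ℕ.≟ i) ×-dec isFace? (F ∷ Q) s) (isFace? Q) (allSubsets n))
          (cong₂ _+_ (countL-cong _ _ (old⇒ , ⇒old) (allSubsets n))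
                     (countL-cong _ _ (new⇒ , ⇒new) (allSubsets n)))
    where
    old⇒ : ∀ {s} → (∣ s ∣ ≡ i × isFace (F ∷ Q) s) × isFace Q s → ∣ s ∣ ≡ i × isFace Q s
    old⇒ ((∣s∣≡i , _) , face) = ∣s∣≡i , face
    ⇒old : ∀ {s} → ∣ s ∣ ≡ i × isFace Q s → (∣ s ∣ ≡ i × isFace (F ∷ Q) s) × isFace Q s
    ⇒old (∣s∣≡i , face) = (∣s∣≡i , there face) , face
    new⇒ : ∀ {s} → (∣ s ∣ ≡ i × isFace (F ∷ Q) s) × ¬ isFace Q s → InInterval R F i s
    new⇒ ((∣s∣≡i , here s⊆F) , ¬face) = ∣s∣≡i , s⊆F , ¬isFace⇒restriction⊆ s⊆F ¬face
    new⇒ ((_ , there face) , ¬face) = contradiction face ¬face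
    ⇒new : ∀ {s} → InInterval R F i s → (∣ s ∣ ≡ i × isFace (F ∷ Q) s) × ¬ isFace Q s
    ⇒new (∣s∣≡i , s⊆F , R⊆s) = (∣s∣≡i , here s⊆F) , restriction⊆⇒¬isFace shelling R⊆s

  -- The boundary ridges of F ∷ Q inside F are the ridges of F not lying in Q.
  boundaryRidgesIn-∷ : ∀ d → boundaryRidgesIn d (F ∷ Q) F ≡ intervalCount R F d
  boundaryRidgesIn-∷ d = countL-cong _ _ (boundary⇒ , ⇒boundary) (allSubsets n)
    where
    boundary⇒ : ∀ {s} → ∣ s ∣ ≡ d × s ⊆ F × containing (F ∷ Q) s ≡ 1 → InInterval R F d s
    boundary⇒ {s} (∣s∣≡d , s⊆F , once) = ∣s∣≡d , s⊆F , ¬isFace⇒restriction⊆ s⊆F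
      (countL≡0⇒¬Any (s ⊆?_) Q (suc-injective (trans (sym (containing-∷ Q s⊆F)) once)))
    ⇒boundary : ∀ {s} → InInterval R F d s → ∣ s ∣ ≡ d × s ⊆ F × containing (F ∷ Q) s ≡ 1
    ⇒boundary {s} (∣s∣≡d , s⊆F , R⊆s) = ∣s∣≡d , s⊆F , trans (containing-∷ Q s⊆F)
      (cong ℕ.suc (¬Any⇒countL≡0 (s ⊆?_) Q (restriction⊆⇒¬isFace shelling R⊆s)))

boundaryRidgesIn-↭ : ∀ d {X Y : List (Subset n)} (F : Subset n) → X ↭ Y →
  boundaryRidgesIn d X F ≡ boundaryRidgesIn d Y F
boundaryRidgesIn-↭ {n} d F X↭Y = countL-cong _ _
  ( (λ {s} (∣s∣≡d , s⊆F , once) → ∣s∣≡d , s⊆F , trans (sym (countL-↭ (s ⊆?_) X↭Y)) once)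
  , (λ {s} (∣s∣≡d , s⊆F , once) → ∣s∣≡d , s⊆F , trans (countL-↭ (s ⊆?_) X↭Y) once))
  (allSubsets n)

faceCount-↭ : ∀ {X Y : List (Subset n)} → X ↭ Y → ∀ i → faceCount X i ≡ faceCount Y i
faceCount-↭ {n} X↭Y i = countL-cong _ _
  ( (λ (∣s∣≡i , face) → ∣s∣≡i , Any-resp-↭ X↭Y face)
  , (λ (∣s∣≡i , face) → ∣s∣≡i , Any-resp-↭ (↭-sym X↭Y) face))
  (allSubsets n)

-- Strong shellings and removal sequences

IsPure : ℕ → List (Subset n) → Set
IsPure d = All (λ F → ∣ F ∣ ≡ suc d)

data IsReverseStrongShelling {n} : List (Subset n) → Set where
  []  : IsReverseStrongShelling []
  _∷_ : ∀ {F Q} → StrongShellingStep F (_∈ₗ Q) → IsReverseStrongShelling Q →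
        IsReverseStrongShelling (F ∷ Q)

markRestrictions : List (Subset n) → Marked n
markRestrictions []      = []
markRestrictions (F ∷ Q) = (F , ∣ restriction F Q ∣) ∷ markRestrictions Q

facetsOf-markRestrictions : (Q : List (Subset n)) → facetsOf (markRestrictions Q) ≡ Q
facetsOf-markRestrictions []      = refl
facetsOf-markRestrictions (F ∷ Q) = cong (F ∷_) (facetsOf-markRestrictions Q)

restrictionSizes : List (Subset n) → List ℕ
restrictionSizes Q = map proj₂ (markRestrictions Q)

restrictionSizes-≤ : ∀ d (Q : List (Subset n)) → IsPure d Q → All (_≤ suc d) (restrictionSizes Q)
restrictionSizes-≤ d []      []             = []
restrictionSizes-≤ d (F ∷ Q) (∣F∣≡1+d ∷ ∣Q∣≡1+d) =
  subst (∣ restriction F Q ∣ ≤_) ∣F∣≡1+d (p⊆q⇒∣p∣≤∣q∣ (restriction⊆ F Q))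
  ∷ restrictionSizes-≤ d Q ∣Q∣≡1+d

hVec≡∑ : ∀ d (Q : List (Subset n)) k → hVec d Q k ≡ ∑[ i < suc k ] hTerm (suc d) k i (faceCount Q i)
hVec≡∑ d Q k = sumTo≡∑ k (λ i → hTerm (suc d) k i (faceCount Q i))

hTerm-+ : ∀ D k i a b → hTerm D k i (a + b) ≡ hTerm D k i a ℤ.+ hTerm D k i b
hTerm-+ D k i a b = trans (cong (sign (k ∸ i) ℤ.* + ((D ∸ i) C (k ∸ i)) ℤ.*_) (ℤ.pos-+ a b))
                          (ℤ.*-distribˡ-+ (sign (k ∸ i) ℤ.* + ((D ∸ i) C (k ∸ i))) (+ a) (+ b))

hVec-[] : ∀ d k → hVec {n} d [] k ≡ + 0
hVec-[] {n} d k = trans (hVec≡∑ {n} d [] k) (trans (∑-cong (suc k) λ i _ →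
  trans (cong (hTerm (suc d) k i) (faceCount-[] i)) (ℤ.*-zeroʳ (sign (k ∸ i) ℤ.* + ((suc d ∸ i) C (k ∸ i)))))
  (∑-zero (suc k)))
  where
  faceCount-[] : ∀ i → faceCount {n} [] i ≡ 0
  faceCount-[] i = countL-none (λ s → (∣ s ∣ ℕ.≟ i) ×-dec isFace? [] s) (λ { (_ , ()) }) (allSubsets n)

hVec≡countL-restrictionSizes : ∀ d {Q : List (Subset n)} → IsPure d Q → IsReverseStrongShelling Q →
  ∀ k → k ≤ suc d → hVec d Q k ≡ + countL (ℕ._≟ k) (restrictionSizes Q)
hVec≡countL-restrictionSizes {n} d [] [] k _ = hVec-[] {n} d k
hVec≡countL-restrictionSizes d {F ∷ Q} (∣F∣≡1+d ∷ pureQ) (shelling ∷ shellingQ) k k≤1+d = begin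
  hVec d (F ∷ Q) k
    ≡⟨ hVec≡∑ d (F ∷ Q) k ⟩
  ∑[ i < suc k ] h i (faceCount (F ∷ Q) i)
    ≡⟨ ∑-cong (suc k) (λ i _ → trans (cong (h i) (faceCount-interval i))
                                     (hTerm-+ (suc d) k i (faceCount Q i) (intervalSize (suc d) r i))) ⟩
  ∑[ i < suc k ] (h i (faceCount Q i) ℤ.+ h i (intervalSize (suc d) r i))
    ≡⟨ ∑-+ (suc k) (λ i → h i (faceCount Q i)) (λ i → h i (intervalSize (suc d) r i)) ⟩
  ∑[ i < suc k ] h i (faceCount Q i) ℤ.+ ∑[ i < suc k ] h i (intervalSize (suc d) r i)
    ≡⟨ cong₂ ℤ._+_ (trans (sym (hVec≡∑ d Q k)) (hVec≡countL-restrictionSizes d pureQ shellingQ k k≤1+d))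
                   (∑-hTerm-intervalSize≡δ (suc d) r k r≤1+d k≤1+d) ⟩
  + countL (ℕ._≟ k) (restrictionSizes Q) ℤ.+ + δ r k
    ≡⟨ ℤ.pos-+ (countL (ℕ._≟ k) (restrictionSizes Q)) (δ r k) ⟨
  + (countL (ℕ._≟ k) (restrictionSizes Q) + δ r k)
    ≡⟨ cong +_ (trans (ℕ.+-comm _ (δ r k)) (sym (countL-++ (ℕ._≟ k) (r ∷ []) (restrictionSizes Q)))) ⟩
  + countL (ℕ._≟ k) (restrictionSizes (F ∷ Q)) ∎
  where
  open ≡-Reasoning
  h = hTerm (suc d) k
  r = ∣ restriction F Q ∣
  r≤1+d : r ≤ suc d
  r≤1+d = subst (r ≤_) ∣F∣≡1+d (p⊆q⇒∣p∣≤∣q∣ (restriction⊆ F Q))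
  faceCount-interval : ∀ i → faceCount (F ∷ Q) i ≡ faceCount Q i + intervalSize (suc d) r i
  faceCount-interval i = trans (faceCount-∷ shelling i) (cong (λ c → faceCount Q i + c)
    (trans (intervalCount≡intervalSize (restriction F Q) F (restriction⊆ F Q) i)
           (cong (λ m → intervalSize m r i) ∣F∣≡1+d)))

hVec-↭ : ∀ d {X Y : List (Subset n)} → X ↭ Y → ∀ k → hVec d X k ≡ hVec d Y k
hVec-↭ d {X} {Y} X↭Y k = trans (hVec≡∑ d X k)
  (trans (∑-cong (suc k) λ i _ → cong (hTerm (suc d) k i) (faceCount-↭ X↭Y i)) (sym (hVec≡∑ d Y k)))

module _ (d : ℕ) {F : Subset n} {Q : List (Subset n)} (shelling : StrongShellingStep F (_∈ₗ Q))
         (sizes : IsPure d (F ∷ Q))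
         (M : Marked n) (M↭ : facetsOf M ↭ F ∷ Q) (p : Fin (length M))
         (lookup≡ : lookup M p ≡ (F , ∣ restriction F Q ∣)) where

  private
    R = restriction F Q
    r = ∣ R ∣
    ∣F∣≡1+d = All.head sizes
    r≤1+d = subst (r ≤_) ∣F∣≡1+d (p⊆q⇒∣p∣≤∣q∣ (restriction⊆ F Q))

  boundaryRidgesIn-last : boundaryRidgesIn d (facetsOf M) F ≡ suc d ∸ r
  boundaryRidgesIn-last = begin
    boundaryRidgesIn d (facetsOf M) F ≡⟨ boundaryRidgesIn-↭ d F M↭ ⟩
    boundaryRidgesIn d (F ∷ Q) F      ≡⟨ boundaryRidgesIn-∷ shelling d ⟩
    intervalCount R F d               ≡⟨ intervalCount≡intervalSize R F (restriction⊆ F Q) d ⟩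
    intervalSize ∣ F ∣ r d            ≡⟨ cong (λ m → intervalSize m r d) ∣F∣≡1+d ⟩
    intervalSize (suc d) r d          ≡⟨ intervalSize-ridge d r r≤1+d ⟩
    suc d ∸ r                         ∎
    where open ≡-Reasoning

  closerFacet : ∀ q → let G = proj₁ (lookup M q) in G ≢ F → Σ (Fin (length M)) λ r′ →
    let H = proj₁ (lookup M r′) in dis F H ≡ 1 × dis G H ≡ dis G F ∸ 1
  closerFacet q G≢F with ∈-resp-↭ M↭ (∈-map⁺ proj₁ (∈-lookup q))
  ... | here G≡F = contradiction G≡F G≢F
  ... | there G∈Q with H , H∈Q , dis≡1 , F─H⊆F─G , H─F⊆G ← shelling G∈Q
                  with r′ , refl ← ∈-map⇒lookup M (∈-resp-↭ (↭-sym M↭) (there H∈Q)) =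
    r′ , dis≡1 ,
    witness⇒dis-pred F _ H (trans ∣F∣≡1+d (sym (All.lookup (All.tail sizes) H∈Q))) dis≡1 F─H⊆F─G H─F⊆G

  isStrongCandidate-last : IsStrongCandidate d M p
  isStrongCandidate-last rewrite lookup≡ = boundaryRidgesIn-last , closerFacet

reverseStrongShelling⇒stronglyRemovable : ∀ d {Q : List (Subset n)} → IsPure d Q →
  IsReverseStrongShelling Q → ∀ {M} → M ↭ markRestrictions Q → StronglyRemovable d M
reverseStrongShelling⇒stronglyRemovable d [] [] M↭[] with refl ← ↭-empty-inv M↭[] = done
reverseStrongShelling⇒stronglyRemovable d {F ∷ Q} sizes (shelling ∷ shellingQ) {M} M↭
  with p , lookup≡ , rest↭ ← ↭-∷⇒removeAt M (markRestrictions Q) M↭ =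
  step M p (isStrongCandidate-last d shelling sizes M facets↭ p lookup≡)
           (reverseStrongShelling⇒stronglyRemovable d (All.tail sizes) shellingQ rest↭)
  where
  facets↭ : facetsOf M ↭ F ∷ Q
  facets↭ = subst (facetsOf M ↭_) (facetsOf-markRestrictions (F ∷ Q)) (map⁺ proj₁ M↭)

facetsOf-↭-removeAt : (M : Marked n) (p : Fin (length M)) →
  facetsOf M ↭ proj₁ (lookup M p) ∷ facetsOf (removeAt M p)
facetsOf-↭-removeAt M p = map⁺ proj₁ (↭-lookup-removeAt M p)

module _ (d : ℕ) (M : Marked n) (p : Fin (length M)) (candidate : IsStrongCandidate d M p)
         (sizes : IsPure d (facetsOf M))
         (F∉rest : All (proj₁ (lookup M p) ≢_) (facetsOf (removeAt M p))) where

  private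
    F = proj₁ (lookup M p)
    facets↭ = facetsOf-↭-removeAt M p
    size : ∀ {G} → G ∈ₗ facetsOf M → ∣ G ∣ ≡ suc d
    size = All.lookup sizes

  strongShellingStep-removed : ∀ {Q} → Q ↭ facetsOf (removeAt M p) → StrongShellingStep F (_∈ₗ Q)
  strongShellingStep-removed {Q} Q↭rest {G} G∈Q
    with q , refl ← ∈-map⇒lookup M (∈-resp-↭ (↭-sym facets↭) (there (∈-resp-↭ Q↭rest G∈Q)))
    with r′ , dis≡1 , dis-pred ← proj₂ candidate q (All.lookup F∉rest (∈-resp-↭ Q↭rest G∈Q) ∘ sym)
    = H , H∈Q , dis-pred⇒witness F G H (trans (size F∈M) (sym (size H∈M))) dis≡1
                                        (trans (size G∈M) (sym (size F∈M))) G≢F dis-pred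
    where
    H = proj₁ (lookup M r′)
    G≢F : G ≢ F
    G≢F = All.lookup F∉rest (∈-resp-↭ Q↭rest G∈Q) ∘ sym
    F∈M = ∈-map⁺ proj₁ (∈-lookup p)
    G∈M = ∈-map⁺ proj₁ (∈-lookup q)
    H∈M = ∈-map⁺ proj₁ (∈-lookup r′)
    H∈Q : H ∈ₗ Q
    H∈Q with ∈-resp-↭ facets↭ H∈M
    ... | here H≡F     = ⊥-elim (0≢1+n (trans (sym (dis-refl F)) (subst (λ X → dis F X ≡ 1) H≡F dis≡1)))
    ... | there H∈rest = ∈-resp-↭ (↭-sym Q↭rest) H∈rest

stronglyRemovable⇒reverseStrongShelling : ∀ d {M : Marked n} → StronglyRemovable d M →
  Unique (facetsOf M) → IsPure d (facetsOf M) →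
  ∃ λ Q → IsReverseStrongShelling Q × Q ↭ facetsOf M
stronglyRemovable⇒reverseStrongShelling d done _ _ = [] , [] , ↭-refl
stronglyRemovable⇒reverseStrongShelling d (step M p candidate removable) unique sizes
  with F∉rest ∷ unique′ ← Unique-resp-↭ (facetsOf-↭-removeAt M p) unique
  with Q , shellingQ , Q↭rest ← stronglyRemovable⇒reverseStrongShelling d removable unique′
                                  (All.tail (All-resp-↭ (facetsOf-↭-removeAt M p) sizes))
  = proj₁ (lookup M p) ∷ Q
  , strongShellingStep-removed d M p candidate sizes F∉rest Q↭rest ∷ shellingQ
  , ↭-trans (↭-prep _ Q↭rest) (↭-sym (facetsOf-↭-removeAt M p))

strongShellingStep-resp : ∀ {F : Subset n} {P P′ : Subset n → Set} →
  (∀ {G} → P G → P′ G) → (∀ {G} → P′ G → P G) → StrongShellingStep F P → StrongShellingStep F P′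
strongShellingStep-resp P⇒P′ P′⇒P shelling P′G with H , PH , witness ← shelling (P′⇒P P′G) =
  H , P⇒P′ PH , witness

-- acc holds the facets already moved, in reverse, in front of L by _ʳ++_.
StepsAfter : List (Subset n) → List (Subset n) → Set
StepsAfter acc L =
  ∀ (j : Fin (length L)) → StrongShellingStep (lookup L j) (λ G → G ∈ₗ acc ⊎ G ∈ₗ take (toℕ j) L)

private
  shift⇒ : ∀ {F G : Subset n} {acc L} → G ∈ₗ acc ⊎ G ∈ₗ F ∷ L → G ∈ₗ F ∷ acc ⊎ G ∈ₗ L
  shift⇒ (inj₁ G∈acc)         = inj₁ (there G∈acc)
  shift⇒ (inj₂ (here G≡F))    = inj₁ (here G≡F)
  shift⇒ (inj₂ (there G∈L))   = inj₂ G∈L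

  shift⇐ : ∀ {F G : Subset n} {acc L} → G ∈ₗ F ∷ acc ⊎ G ∈ₗ L → G ∈ₗ acc ⊎ G ∈ₗ F ∷ L
  shift⇐ (inj₁ (here G≡F))    = inj₂ (here G≡F)
  shift⇐ (inj₁ (there G∈acc)) = inj₁ G∈acc
  shift⇐ (inj₂ G∈L)           = inj₂ (there G∈L)

  fromInj₁ : ∀ {G : Subset n} {acc} → G ∈ₗ acc ⊎ G ∈ₗ [] → G ∈ₗ acc
  fromInj₁ (inj₁ G∈acc) = G∈acc

reverseStrongShelling-ʳ++⁺ : ∀ (acc L : List (Subset n)) →
  IsReverseStrongShelling acc → StepsAfter acc L → IsReverseStrongShelling (L ʳ++ acc)
reverseStrongShelling-ʳ++⁺ acc []      shelling _     = shelling
reverseStrongShelling-ʳ++⁺ acc (F ∷ L) shelling steps = reverseStrongShelling-ʳ++⁺ (F ∷ acc) L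
  (strongShellingStep-resp fromInj₁ inj₁ (steps zero) ∷ shelling)
  (λ j → strongShellingStep-resp shift⇒ shift⇐ (steps (suc j)))

reverseStrongShelling-ʳ++⁻ : ∀ (acc L : List (Subset n)) → IsReverseStrongShelling (L ʳ++ acc) →
  IsReverseStrongShelling acc × StepsAfter acc L
reverseStrongShelling-ʳ++⁻ acc []      shelling = shelling , λ ()
reverseStrongShelling-ʳ++⁻ acc (F ∷ L) shelling
  with stepF ∷ shellingAcc , steps ← reverseStrongShelling-ʳ++⁻ (F ∷ acc) L shelling =
  shellingAcc , λ where
    zero    → strongShellingStep-resp inj₁ fromInj₁ stepF
    (suc j) → strongShellingStep-resp shift⇐ shift⇒ (steps j)

lookup∈take : ∀ (L : List (Subset n)) {i j : Fin (length L)} → i Fin.< j →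
  lookup L i ∈ₗ take (toℕ j) L
lookup∈take (F ∷ L) {zero}  {suc j} _         = here refl
lookup∈take (F ∷ L) {suc i} {suc j} (s≤s i<j) = there (lookup∈take L i<j)

∈take⇒lookup : ∀ (L : List (Subset n)) (j : Fin (length L)) {G} → G ∈ₗ take (toℕ j) L →
  ∃ λ i → i Fin.< j × lookup L i ≡ G
∈take⇒lookup (F ∷ L) (suc j) (here refl)  = zero , s≤s z≤n , refl
∈take⇒lookup (F ∷ L) (suc j) (there G∈L) with i , i<j , lookup≡G ← ∈take⇒lookup L j G∈L =
  suc i , s≤s i<j , lookup≡G

strongShellingOrder⇒stepsAfter : (L : List (Subset n)) → IsStrongShellingOrder L → StepsAfter [] L
strongShellingOrder⇒stepsAfter L order j (inj₂ G∈L)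
  with i , i<j , refl ← ∈take⇒lookup L j G∈L
  with k , k<j , witness ← order i j i<j = lookup L k , inj₂ (lookup∈take L k<j) , witness

stepsAfter⇒strongShellingOrder : (L : List (Subset n)) → StepsAfter [] L → IsStrongShellingOrder L
stepsAfter⇒strongShellingOrder L steps i j i<j with steps j (inj₂ (lookup∈take L i<j))
... | H , inj₂ H∈L , witness with k , k<j , refl ← ∈take⇒lookup L j H∈L = k , k<j , witness

strongShellingOrder⇒reverse : (L : List (Subset n)) → IsStrongShellingOrder L →
  IsReverseStrongShelling (reverse L)
strongShellingOrder⇒reverse L order =
  reverseStrongShelling-ʳ++⁺ [] L [] (strongShellingOrder⇒stepsAfter L order)

reverse⇒strongShellingOrder : (Q : List (Subset n)) → IsReverseStrongShelling Q →
  IsStrongShellingOrder (reverse Q)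
reverse⇒strongShellingOrder Q shelling = stepsAfter⇒strongShellingOrder (reverse Q) (proj₂
  (reverseStrongShelling-ʳ++⁻ [] (reverse Q) (subst IsReverseStrongShelling (sym (reverse-involutive Q)) shelling)))

RemovableUnderHAssignment : ℕ → List (Subset n) → Set
RemovableUnderHAssignment d facets =
  Σ (List ℕ) λ A → IsHAssignment d facets A × StronglyRemovable d (zip facets A)

reverseStrongShelling⇒removable : ∀ d {Q facets : List (Subset n)} → Q ↭ facets →
  IsPure d facets → IsReverseStrongShelling Q → RemovableUnderHAssignment d facets
reverseStrongShelling⇒removable d {Q} Q↭facets sizes shelling
  with Z , refl , M↭Z ← ↭-map-inv proj₁ (subst (_↭ _) (sym (facetsOf-markRestrictions Q)) Q↭facets) =
  map proj₂ Z , (length≡ , bounded , counts) ,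
  subst (StronglyRemovable d) (sym (zip-map-proj Z))
        (reverseStrongShelling⇒stronglyRemovable d sizesQ shelling (↭-sym M↭Z))
  where
  sizesQ = All-resp-↭ (↭-sym Q↭facets) sizes
  sizes↭ : restrictionSizes Q ↭ map proj₂ Z
  sizes↭ = map⁺ proj₂ M↭Z
  length≡ : length (map proj₂ Z) ≡ length (map proj₁ Z)
  length≡ = trans (length-map proj₂ Z) (sym (length-map proj₁ Z))
  bounded : ∀ p → lookup (map proj₂ Z) p ≤ suc d
  bounded p = All.lookup (All-resp-↭ sizes↭ (restrictionSizes-≤ d Q sizesQ)) (∈-lookup p)
  counts : ∀ i → i ≤ suc d → + countL (ℕ._≟ i) (map proj₂ Z) ≡ hVec d (map proj₁ Z) i
  counts i i≤1+d = trans (cong +_ (sym (countL-↭ (ℕ._≟ i) sizes↭)))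
    (trans (sym (hVec≡countL-restrictionSizes d sizesQ shelling i i≤1+d)) (hVec-↭ d Q↭facets i))

stronglyShellable⇒removable : ∀ d {facets : List (Subset n)} → IsPure d facets →
  StronglyShellable facets → RemovableUnderHAssignment d facets
stronglyShellable⇒removable d sizes (L , L↭facets , order) =
  reverseStrongShelling⇒removable d (↭-trans (↭-reverse L) L↭facets) sizes (strongShellingOrder⇒reverse L order)

stronglyRemovable⇒stronglyShellable : ∀ d {M : Marked n} → StronglyRemovable d M →
  Unique (facetsOf M) → IsPure d (facetsOf M) → StronglyShellable (facetsOf M)
stronglyRemovable⇒stronglyShellable d removable unique sizes
  with Q , shelling , Q↭ ← stronglyRemovable⇒reverseStrongShelling d removable unique sizes =
  reverse Q , ↭-trans (↭-reverse Q) Q↭ , reverse⇒strongShellingOrder Q shelling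

removable⇒stronglyShellable : ∀ d {facets : List (Subset n)} → Unique facets → IsPure d facets →
  RemovableUnderHAssignment d facets → StronglyShellable facets
removable⇒stronglyShellable d {facets} unique sizes (A , (length≡ , _) , removable) =
  subst StronglyShellable facets≡ (stronglyRemovable⇒stronglyShellable d removable
    (subst Unique (sym facets≡) unique) (subst (IsPure d) (sym facets≡) sizes))
  where
  facets≡ : facetsOf (zip facets A) ≡ facets
  facets≡ = map-proj₁-zip facets A length≡

theorem7p2 : (n d : ℕ) (facets : List (Subset n)) →
    facets ≢ [] → Unique facets → All (λ F → ∣ F ∣ ≡ suc d) facets →
    StronglyShellable facets ⇔
      Σ (List ℕ) (λ A → IsHAssignment d facets A × StronglyRemovable d (zip facets A))
theorem7p2 n d facets _ unique sizes = mk⇔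
  (stronglyShellable⇒removable d sizes) (removable⇒stronglyShellable d unique sizes)
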